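{- Let $n\ge t\ge 3$, let $\Gamma$ be a finite group and let $\Gamma'$ be a nontrivial subgroup of $\Gamma$. If $\psi\colon E(Q_t(\Gamma'))\to E(Q_n(\Gamma))$ is an embedding, then $\psi(J(Q_t(\Gamma')))\subseteq J(Q_n(\Gamma))$.
   Context: For a finite group $\Gamma$, $K_n^\Gamma$ is the $\Gamma$-gain graph on vertex set $[n]$ having, for each $1\le i<j\le n$ and each $x\in\Gamma$, an edge $x_{ij}$ oriented from $i$ to $j$ with label $x$, and for each $i$ a loop $b_i$. A cycle with at least two edges is balanced if the product of its labels (each raised to $\pm1$ according to whether the traversal agrees with its orientation) is the identity, otherwise unbalanced; loops are unbalanced. The frame matroid $\mathrm{FM}(G)$ of a gain graph $G$ has ground set $E(G)$ and its circuits are the edge sets of balanced cycles, of two unbalanced cycles sharing exactly one vertex, of two vertex-disjoint unbalanced cycles joined by a path meeting them only at its ends, and of theta subgraphs all of whose cycles are unbalanced. The Dowling geometry is $Q_n(\Gamma)=\mathrm{FM}(K_n^\Gamma)$, and its joints are the elements $b_1,\dots,b_n$; $J(Q_n(\Gamma))$ denotes the set of joints. An injective map $\psi\colon E(N)\to E(M)$ is an embedding if $M$ restricted to $\psi(E(N))$ is isomorphic to $N$ via $\psi$. -}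

module Defs where

open import Level using (0ℓ)
open import Data.Nat using (ℕ)
open import Data.Fin using (Fin; _<_)
open import Data.List using (List; []; _∷_; _++_)
open import Data.List.Membership.Propositional using (_∈_; _∉_)
open import Data.List.Relation.Unary.Unique.Propositional using (Unique)
open import Data.Product using (Σ; ∃; _×_; _,_)
open import Data.Sum using (_⊎_)
open import Data.Empty using (⊥)
open import Relation.Nullary using (¬_)
open import Relation.Unary using (Pred)
open import Relation.Binary.PropositionalEquality using (_≡_; _≢_)
open import Algebra.Structures using (IsGroup)
open import Function.Bundles using (_↔_)
open import Function.Definitions using (Injective)

record FinGroup : Set₁ where
  infixl 7 _∙_
  field
    Carrier : Set
    _∙_     : Carrier → Carrier → Carrier
    ε       : Carrier
    _⁻¹     : Carrier → Carrier
    isGroup : IsGroup _≡_ _∙_ ε _⁻¹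
    order   : ℕ
    enum    : Fin order ↔ Carrier

open FinGroup public using () renaming (Carrier to ∣_∣)

IsSubgroupEmbedding : (Γ' Γ : FinGroup) → (∣ Γ' ∣ → ∣ Γ ∣) → Set
IsSubgroupEmbedding Γ' Γ ι =
  Injective _≡_ _≡_ ι ×
  (∀ x y → ι (FinGroup._∙_ Γ' x y) ≡ FinGroup._∙_ Γ (ι x) (ι y))

Nontrivial : FinGroup → Set
Nontrivial Γ = ∃ λ (x : ∣ Γ ∣) → x ≢ FinGroup.ε Γ

Disjoint : {A : Set} → List A → List A → Set
Disjoint xs ys = ∀ {x} → x ∈ xs → x ∈ ys → ⊥

module Gain (Γ : FinGroup) (n : ℕ) where
  open FinGroup Γ

  V : Set
  V = Fin n

  -- edges of K_n^Γ: loops b_i, and for i<j and x ∈ Γ the edge x_ij (oriented i→j)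
  data Edge : Set where
    loop : V → Edge
    arc  : (i j : V) → i < j → Carrier → Edge

  data Step : V → V → Set where
    fwd : ∀ {i j} → i < j → Carrier → Step i j
    bwd : ∀ {i j} → i < j → Carrier → Step j i

  stepEdge : ∀ {u v} → Step u v → Edge
  stepEdge (fwd {i} {j} p x) = arc i j p x
  stepEdge (bwd {i} {j} p x) = arc i j p x

  stepGain : ∀ {u v} → Step u v → Carrier
  stepGain (fwd _ x) = x
  stepGain (bwd _ x) = x ⁻¹

  data Walk : V → V → Set where
    []  : ∀ {u} → Walk u u
    _∷_ : ∀ {u v w} → Step u v → Walk v w → Walk u w

  walkEdges : ∀ {u v} → Walk u v → List Edge
  walkEdges []      = []
  walkEdges (s ∷ w) = stepEdge s ∷ walkEdges w

  walkVerts : ∀ {u v} → Walk u v → List V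
  walkVerts ([] {u})     = u ∷ []
  walkVerts (_∷_ {u} s w) = u ∷ walkVerts w

  walkGain : ∀ {u v} → Walk u v → Carrier
  walkGain []      = ε
  walkGain (s ∷ w) = stepGain s ∙ walkGain w

  IsPath : ∀ {u v} → Walk u v → Set
  IsPath w = Unique (walkVerts w)

  data Cycle : Set where
    loopC : V → Cycle
    polyC : ∀ {u v} (s : Step u v) (p : Walk v u) →
            IsPath p → stepEdge s ∉ walkEdges p → Cycle

  cycEdges : Cycle → List Edge
  cycEdges (loopC i)         = loop i ∷ []
  cycEdges (polyC s p _ _)   = stepEdge s ∷ walkEdges p

  cycVerts : Cycle → List V
  cycVerts (loopC i)         = i ∷ []
  cycVerts (polyC s p _ _)   = walkVerts p

  Balanced : Cycle → Set
  Balanced (loopC _)         = ⊥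
  Balanced (polyC s p _ _)   = stepGain s ∙ walkGain p ≡ ε

  Unbalanced : Cycle → Set
  Unbalanced c = ¬ Balanced c

  data CircuitGraph : List Edge → Set where
    balancedCycle : (c : Cycle) → Balanced c → CircuitGraph (cycEdges c)
    tightHandcuff : (c₁ c₂ : Cycle) → Unbalanced c₁ → Unbalanced c₂ →
      Disjoint (cycEdges c₁) (cycEdges c₂) →
      (w : V) → w ∈ cycVerts c₁ → w ∈ cycVerts c₂ →
      (∀ {x} → x ∈ cycVerts c₁ → x ∈ cycVerts c₂ → x ≡ w) →
      CircuitGraph (cycEdges c₁ ++ cycEdges c₂)
    looseHandcuff : (c₁ c₂ : Cycle) → Unbalanced c₁ → Unbalanced c₂ →
      Disjoint (cycVerts c₁) (cycVerts c₂) →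
      ∀ {u v} (p : Walk u v) → IsPath p →
      u ∈ cycVerts c₁ → v ∈ cycVerts c₂ →
      (∀ {x} → x ∈ walkVerts p → x ∈ cycVerts c₁ → x ≡ u) →
      (∀ {x} → x ∈ walkVerts p → x ∈ cycVerts c₂ → x ≡ v) →
      CircuitGraph (cycEdges c₁ ++ walkEdges p ++ cycEdges c₂)
    theta : ∀ {u v} → u ≢ v → (p₁ p₂ p₃ : Walk u v) →
      IsPath p₁ → IsPath p₂ → IsPath p₃ →
      (∀ {x} → x ∈ walkVerts p₁ → x ∈ walkVerts p₂ → x ≡ u ⊎ x ≡ v) →
      (∀ {x} → x ∈ walkVerts p₁ → x ∈ walkVerts p₃ → x ≡ u ⊎ x ≡ v) →
      (∀ {x} → x ∈ walkVerts p₂ → x ∈ walkVerts p₃ → x ≡ u ⊎ x ≡ v) →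
      Disjoint (walkEdges p₁) (walkEdges p₂) →
      Disjoint (walkEdges p₁) (walkEdges p₃) →
      Disjoint (walkEdges p₂) (walkEdges p₃) →
      -- the three cycles p_i · p_j^{-1} are unbalanced
      walkGain p₁ ∙ (walkGain p₂) ⁻¹ ≢ ε →
      walkGain p₁ ∙ (walkGain p₃) ⁻¹ ≢ ε →
      walkGain p₂ ∙ (walkGain p₃) ⁻¹ ≢ ε →
      CircuitGraph (walkEdges p₁ ++ walkEdges p₂ ++ walkEdges p₃)

  -- circuits of Q_n(Γ) = FM(K_n^Γ), as subsets of the ground set E(K_n^Γ)
  IsCircuit : Pred Edge 0ℓ → Set
  IsCircuit C = Σ (List Edge) λ es →
    CircuitGraph es × (∀ e → (C e → e ∈ es) × (e ∈ es → C e))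

  -- joints J(Q_n(Γ)) = {b_1, …, b_n}
  IsJoint : Edge → Set
  IsJoint e = ∃ λ i → e ≡ loop i

image : {A B : Set} → (A → B) → Pred A 0ℓ → Pred B 0ℓ
image ψ C b = ∃ λ a → C a × ψ a ≡ b

-- ψ : E(Q_t(Γ')) → E(Q_n(Γ)) is an embedding: injective, and the restriction
-- of Q_n(Γ) to ψ(E(Q_t(Γ'))) is isomorphic to Q_t(Γ') via ψ, i.e. C is a
-- circuit of Q_t(Γ') iff ψ(C) is a circuit of Q_n(Γ).
IsEmbedding : (Γ' : FinGroup) (t : ℕ) (Γ : FinGroup) (n : ℕ) →
  (Gain.Edge Γ' t → Gain.Edge Γ n) → Set₁
IsEmbedding Γ' t Γ n ψ =
  Injective _≡_ _≡_ ψ ×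
  (∀ (C : Pred (Gain.Edge Γ' t) 0ℓ) →
     (Gain.IsCircuit Γ' t C → Gain.IsCircuit Γ n (image ψ C)) ×
     (Gain.IsCircuit Γ n (image ψ C) → Gain.IsCircuit Γ' t C))

-- In a circuit of a frame matroid every end of an edge is also an end of another edge of the
-- circuit. So if an arc A lies in three 3-element circuits {A, P, Q}, {A, P, R}, {A, Q, R}, then P
-- has its ends among those of A; and any three distinct edges spanned by the two ends of an arc
-- form a circuit (a handcuff or a theta). Suppose ψ(bᵢ) = A is an arc and pick x ≠ 1 in Γ′. For
-- j ≠ i the triangles {bᵢ, bⱼ, 1ᵢⱼ}, {bᵢ, bⱼ, xᵢⱼ}, {bᵢ, 1ᵢⱼ, xᵢⱼ} of Q_t(Γ′) confine ψ(bⱼ) to the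
-- ends of A. Taking two such j, k (here t ≥ 3 is used), {A, ψ(bⱼ), ψ(bₖ)} is a circuit of Q_n(Γ),
-- whereas three joints {bᵢ, bⱼ, bₖ} never form a circuit.

module Submission where

open import Level using (0ℓ)
open import Defs
open import Data.Nat using (ℕ; _+_; _≤_; s≤s)
open import Data.Fin using (Fin; zero; suc; _<_; _≟_)
open import Data.Fin.Properties using (<-cmp; <⇒≢; <-asym; <-irrelevant)
open import Data.List using (List; []; _∷_; _++_; map)
open import Data.List.Membership.Propositional using (_∈_; _∉_)
open import Data.List.Membership.Propositional.Properties using (∈-++⁻; ∈-map⁺; ∈-map⁻)
open import Data.List.Relation.Binary.Subset.Propositional using (_⊆_)
open import Data.List.Relation.Binary.Subset.Propositional.Properties using (xs⊆xs++ys; xs⊆ys++xs)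
open import Data.List.Relation.Binary.Permutation.Propositional
  using (_↭_; ↭-refl; ↭-prep; ↭-swap; ↭-sym)
open import Data.List.Relation.Binary.Permutation.Propositional.Properties using (∈-resp-↭)
open import Data.List.Relation.Unary.Any using (here; there)
open import Data.List.Relation.Unary.Any.Properties using (singleton⁻)
open import Data.List.Relation.Unary.All using ([]; _∷_)
open import Data.List.Relation.Unary.All.Properties using (All¬⇒¬Any)
open import Data.List.Relation.Unary.AllPairs using ([]; _∷_)
open import Data.Product using (∃; ∃₂; Σ; _×_; _,_; proj₁; proj₂)
open import Data.Sum using (_⊎_; inj₁; inj₂; [_,_]′; map₂; fromInj₂) renaming (swap to ⊎-swap)
open import Data.Empty using (⊥; ⊥-elim)
open import Data.Unit using (⊤; tt)
open import Function using (_∘_; flip)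
open import Function.Bundles using (_⇔_; mk⇔; Equivalence)
open import Relation.Nullary using (¬_; yes; no)
open import Relation.Unary using (Pred; _≐_)
open import Relation.Unary.Properties using (≐-sym)
open import Relation.Binary.PropositionalEquality using (_≡_; _≢_; refl; sym; trans; subst; subst₂)
open import Relation.Binary.Definitions using (tri<; tri≈; tri>)
open import Algebra.Bundles using (Group)
import Algebra.Properties.Group as GroupProperties

module FrameMatroid (Γ : FinGroup) (n : ℕ) where
  open FinGroup Γ
  open Gain Γ n

  private
    group : Group 0ℓ 0ℓ
    group = record
      { Carrier = Carrier ; _≈_ = _≡_ ; _∙_ = _∙_ ; ε = ε ; _⁻¹ = _⁻¹ ; isGroup = isGroup }

    open Group group using (identityʳ)
    open GroupProperties group using (x∙y⁻¹≈ε⇒x≈y)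

    variable
      a b u v w x y : V
      e P Q R : Edge
      es xs ys : List Edge
      g h : Carrier

  Incident : V → Edge → Set
  Incident x (loop i)      = x ≡ i
  Incident x (arc i j _ _) = x ≡ i ⊎ x ≡ j

  IsArc : Edge → Set
  IsArc (loop _)      = ⊥
  IsArc (arc _ _ _ _) = ⊤

  EdgeAt : List Edge → V → Set
  EdgeAt es x = ∃ λ e → e ∈ es × Incident x e

  OtherEdgeAt : List Edge → Edge → V → Set
  OtherEdgeAt es e x = ∃ λ e′ → e′ ∈ es × e′ ≢ e × Incident x e′

  edgeAt-⊆ : xs ⊆ ys → EdgeAt xs x → EdgeAt ys x
  edgeAt-⊆ xs⊆ys (e , e∈xs , x∈e) = e , xs⊆ys e∈xs , x∈e

  otherEdgeAt-⊆ : xs ⊆ ys → OtherEdgeAt xs e x → OtherEdgeAt ys e x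
  otherEdgeAt-⊆ xs⊆ys (e′ , e′∈xs , e′≢e , x∈e′) = e′ , xs⊆ys e′∈xs , e′≢e , x∈e′

  edgeAt⇒otherEdgeAt : e ∉ es → EdgeAt es x → OtherEdgeAt es e x
  edgeAt⇒otherEdgeAt e∉es (e′ , e′∈es , x∈e′) = e′ , e′∈es , (λ { refl → e∉es e′∈es }) , x∈e′

  arc-otherEnd : IsArc e → Incident x e → ∃ λ y → y ≢ x × Incident y e
  arc-otherEnd {arc i j i<j _} _ (inj₁ refl) = j , <⇒≢ i<j ∘ sym , inj₂ refl
  arc-otherEnd {arc i j i<j _} _ (inj₂ refl) = i , <⇒≢ i<j , inj₁ refl

  incident-atMostTwo : Incident x e → Incident a e → Incident b e → x ≢ a → x ≢ b → a ≢ b → ⊥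
  incident-atMostTwo {e = loop _} refl refl _ x≢a _ _ = x≢a refl
  incident-atMostTwo {e = arc _ _ _ _} (inj₁ refl) (inj₁ refl) _ x≢a _ _ = x≢a refl
  incident-atMostTwo {e = arc _ _ _ _} (inj₂ refl) (inj₂ refl) _ x≢a _ _ = x≢a refl
  incident-atMostTwo {e = arc _ _ _ _} (inj₁ refl) _ (inj₁ refl) _ x≢b _ = x≢b refl
  incident-atMostTwo {e = arc _ _ _ _} (inj₂ refl) _ (inj₂ refl) _ x≢b _ = x≢b refl
  incident-atMostTwo {e = arc _ _ _ _} _ (inj₁ refl) (inj₁ refl) _ _ a≢b = a≢b refl
  incident-atMostTwo {e = arc _ _ _ _} _ (inj₂ refl) (inj₂ refl) _ _ a≢b = a≢b refl

  step-≢ : Step u v → u ≢ v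
  step-≢ (fwd u<v _) = <⇒≢ u<v
  step-≢ (bwd v<u _) = <⇒≢ v<u ∘ sym

  step-endpoint-incident : (s : Step u v) → x ≡ u ⊎ x ≡ v → Incident x (stepEdge s)
  step-endpoint-incident (fwd _ _) x-end = x-end
  step-endpoint-incident (bwd _ _) x-end = ⊎-swap x-end

  step-incident⇒endpoint : (s : Step u v) → Incident x (stepEdge s) → x ≡ u ⊎ x ≡ v
  step-incident⇒endpoint (fwd _ _) x∈s = x∈s
  step-incident⇒endpoint (bwd _ _) x∈s = ⊎-swap x∈s

  walk-isArc : (p : Walk u v) → e ∈ walkEdges p → IsArc e
  walk-isArc (fwd _ _ ∷ _) (here refl) = tt
  walk-isArc (bwd _ _ ∷ _) (here refl) = tt
  walk-isArc (_ ∷ p)       (there e∈p) = walk-isArc p e∈p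

  endpoint∈walkVerts : (p : Walk u v) → x ≡ u ⊎ x ≡ v → x ∈ walkVerts p
  endpoint∈walkVerts []      (inj₁ refl) = here refl
  endpoint∈walkVerts []      (inj₂ refl) = here refl
  endpoint∈walkVerts (_ ∷ _) (inj₁ refl) = here refl
  endpoint∈walkVerts (_ ∷ p) (inj₂ refl) = there (endpoint∈walkVerts p (inj₂ refl))

  walk-incident⇒∈walkVerts : (p : Walk u v) → e ∈ walkEdges p → Incident x e → x ∈ walkVerts p
  walk-incident⇒∈walkVerts (s ∷ p) (here refl) x∈s with step-incident⇒endpoint s x∈s
  ... | inj₁ refl = here refl
  ... | inj₂ refl = there (endpoint∈walkVerts p (inj₁ refl))
  walk-incident⇒∈walkVerts (_ ∷ p) (there e∈p) x∈e = there (walk-incident⇒∈walkVerts p e∈p x∈e)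

  walk-edgeAt : (p : Walk u v) → u ≢ v → x ∈ walkVerts p → EdgeAt (walkEdges p) x
  walk-edgeAt []      u≢u _ = ⊥-elim (u≢u refl)
  walk-edgeAt (s ∷ p) _     = nonempty-edgeAt s p
    where
      nonempty-edgeAt : (s : Step u w) (p : Walk w v) → x ∈ walkVerts (s ∷ p) → EdgeAt (walkEdges (s ∷ p)) x
      nonempty-edgeAt s _        (here refl)         = stepEdge s , here refl , step-endpoint-incident s (inj₁ refl)
      nonempty-edgeAt s []       (there (here refl)) = stepEdge s , here refl , step-endpoint-incident s (inj₂ refl)
      nonempty-edgeAt _ (s′ ∷ p) (there x∈p)         = edgeAt-⊆ there (nonempty-edgeAt s′ p x∈p)

  path-head∉tail : (s : Step u w) (p : Walk w v) → IsPath (s ∷ p) → stepEdge s ∉ walkEdges p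
  path-head∉tail s p (u∉p ∷ _) s∈p =
    All¬⇒¬Any u∉p (walk-incident⇒∈walkVerts p s∈p (step-endpoint-incident s (inj₁ refl)))

  path-otherEdgeAt : (p : Walk u v) → IsPath p → e ∈ walkEdges p → Incident x e →
                     OtherEdgeAt (walkEdges p) e x ⊎ (x ≡ u ⊎ x ≡ v)
  path-otherEdgeAt (s ∷ []) _ (here refl) x∈s = inj₂ (step-incident⇒endpoint s x∈s)
  path-otherEdgeAt (s ∷ p@(s′ ∷ _)) path (here refl) x∈s with step-incident⇒endpoint s x∈s
  ... | inj₁ x≡u  = inj₂ (inj₁ x≡u)
  ... | inj₂ refl = inj₁ (otherEdgeAt-⊆ there (edgeAt⇒otherEdgeAt (path-head∉tail s p path)
                            (stepEdge s′ , here refl , step-endpoint-incident s′ (inj₁ refl))))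
  path-otherEdgeAt (s ∷ p) path@(_ ∷ p-path) (there e∈p) x∈e with path-otherEdgeAt p p-path e∈p x∈e
  ... | inj₁ other       = inj₁ (otherEdgeAt-⊆ there other)
  ... | inj₂ (inj₂ x≡v)  = inj₂ (inj₂ x≡v)
  ... | inj₂ (inj₁ refl) = inj₁ (stepEdge s , here refl , (λ { refl → path-head∉tail s p path e∈p }) ,
                                 step-endpoint-incident s (inj₂ refl))

  polygon-otherEdgeAt : (s : Step u v) (p : Walk v u) → IsPath p → stepEdge s ∉ walkEdges p →
                        e ∈ stepEdge s ∷ walkEdges p → Incident x e →
                        OtherEdgeAt (stepEdge s ∷ walkEdges p) e x
  polygon-otherEdgeAt s p _ s∉p (here refl) x∈s =
    otherEdgeAt-⊆ there (edgeAt⇒otherEdgeAt s∉p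
      (walk-edgeAt p (step-≢ s ∘ sym) (endpoint∈walkVerts p (⊎-swap (step-incident⇒endpoint s x∈s)))))
  polygon-otherEdgeAt s p p-path s∉p (there e∈p) x∈e with path-otherEdgeAt p p-path e∈p x∈e
  ... | inj₁ other = otherEdgeAt-⊆ there other
  ... | inj₂ x-end =
    stepEdge s , here refl , (λ { refl → s∉p e∈p }) , step-endpoint-incident s (⊎-swap x-end)

  cycle-edgeAt : (c : Cycle) → x ∈ cycVerts c → EdgeAt (cycEdges c) x
  cycle-edgeAt (loopC i)       (here refl) = loop i , here refl , refl
  cycle-edgeAt (polyC s p _ _) x∈p         = edgeAt-⊆ there (walk-edgeAt p (step-≢ s ∘ sym) x∈p)

  cycle-incident⇒∈cycVerts : (c : Cycle) → e ∈ cycEdges c → Incident x e → x ∈ cycVerts c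
  cycle-incident⇒∈cycVerts (loopC _)       (here refl) refl = here refl
  cycle-incident⇒∈cycVerts (polyC s p _ _) (here refl) x∈s  =
    endpoint∈walkVerts p (⊎-swap (step-incident⇒endpoint s x∈s))
  cycle-incident⇒∈cycVerts (polyC _ p _ _) (there e∈p) x∈e  = walk-incident⇒∈walkVerts p e∈p x∈e

  tightHandcuff-side : (c c′ : Cycle) → Disjoint (cycEdges c) (cycEdges c′) →
                       w ∈ cycVerts c → w ∈ cycVerts c′ → e ∈ cycEdges c → Incident x e →
                       OtherEdgeAt (cycEdges c) e x ⊎ OtherEdgeAt (cycEdges c′) e x
  tightHandcuff-side (loopC _) c′ disjoint (here refl) w∈c′ (here refl) refl =
    inj₂ (edgeAt⇒otherEdgeAt (disjoint (here refl)) (cycle-edgeAt c′ w∈c′))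
  tightHandcuff-side (polyC s p p-path s∉p) _ _ _ _ e∈c x∈e =
    inj₁ (polygon-otherEdgeAt s p p-path s∉p e∈c x∈e)

  looseHandcuff-side : (c : Cycle) (p : Walk u v) → u ≢ v →
                       w ∈ cycVerts c → w ∈ walkVerts p → e ∈ cycEdges c → Incident x e →
                       OtherEdgeAt (cycEdges c) e x ⊎ OtherEdgeAt (walkEdges p) e x
  looseHandcuff-side (loopC _) p u≢v (here refl) w∈p (here refl) refl =
    inj₂ (edgeAt⇒otherEdgeAt (walk-isArc p) (walk-edgeAt p u≢v w∈p))
  looseHandcuff-side (polyC s p p-path s∉p) _ _ _ _ e∈c x∈e =
    inj₁ (polygon-otherEdgeAt s p p-path s∉p e∈c x∈e)

  -- An edge of p at x lying on c would have its other end in both p and c, i.e. at x.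
  junction-otherEdgeAt : (c : Cycle) (p : Walk u v) → x ∈ cycVerts c →
                         (∀ {y} → y ∈ walkVerts p → y ∈ cycVerts c → y ≡ x) →
                         e ∈ walkEdges p → Incident x e → OtherEdgeAt (cycEdges c) e x
  junction-otherEdgeAt c p x∈c meetOnlyAt-x e∈p x∈e = edgeAt⇒otherEdgeAt e∉c (cycle-edgeAt c x∈c)
    where
      e∉c : _ ∉ cycEdges c
      e∉c e∈c with arc-otherEnd (walk-isArc p e∈p) x∈e
      ... | y , y≢x , y∈e =
        y≢x (meetOnlyAt-x (walk-incident⇒∈walkVerts p e∈p y∈e) (cycle-incident⇒∈cycVerts c e∈c y∈e))

  theta-side : u ≢ v → (p q : Walk u v) → IsPath p → Disjoint (walkEdges p) (walkEdges q) →
               e ∈ walkEdges p → Incident x e →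
               OtherEdgeAt (walkEdges p) e x ⊎ OtherEdgeAt (walkEdges q) e x
  theta-side u≢v p q p-path disjoint e∈p x∈e =
    map₂ (edgeAt⇒otherEdgeAt (disjoint e∈p) ∘ walk-edgeAt q u≢v ∘ endpoint∈walkVerts q)
         (path-otherEdgeAt p p-path e∈p x∈e)

  circuit-otherEdgeAt : CircuitGraph es → e ∈ es → Incident x e → OtherEdgeAt es e x
  circuit-otherEdgeAt (balancedCycle (polyC s p p-path s∉p) _) = polygon-otherEdgeAt s p p-path s∉p
  circuit-otherEdgeAt (tightHandcuff c₁ c₂ _ _ disjoint _ w∈c₁ w∈c₂ _) e∈es x∈e =
    [ (λ e∈c₁ → [ into₁ , into₂ ]′ (tightHandcuff-side c₁ c₂ disjoint w∈c₁ w∈c₂ e∈c₁ x∈e))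
    , (λ e∈c₂ → [ into₂ , into₁ ]′ (tightHandcuff-side c₂ c₁ (flip disjoint) w∈c₂ w∈c₁ e∈c₂ x∈e))
    ]′ (∈-++⁻ (cycEdges c₁) e∈es)
    where
      into₁ = otherEdgeAt-⊆ (xs⊆xs++ys (cycEdges c₁) (cycEdges c₂))
      into₂ = otherEdgeAt-⊆ (xs⊆ys++xs (cycEdges c₂) (cycEdges c₁))
  circuit-otherEdgeAt {e = e} (looseHandcuff c₁ c₂ _ _ disjoint p p-path u∈c₁ v∈c₂ meet₁ meet₂) e∈es x∈e =
    [ onCycle₁ x∈e , [ onPath x∈e , onCycle₂ x∈e ]′ ∘ ∈-++⁻ (walkEdges p) ]′ (∈-++⁻ (cycEdges c₁) e∈es)
    where
      handcuff = cycEdges c₁ ++ walkEdges p ++ cycEdges c₂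
      u≢v = λ { refl → disjoint u∈c₁ v∈c₂ }
      into₁ : OtherEdgeAt (cycEdges c₁) e y → OtherEdgeAt handcuff e y
      into₁ = otherEdgeAt-⊆ (xs⊆xs++ys (cycEdges c₁) (walkEdges p ++ cycEdges c₂))
      into₂ : OtherEdgeAt (walkEdges p) e y → OtherEdgeAt handcuff e y
      into₂ = otherEdgeAt-⊆ (xs⊆ys++xs (walkEdges p ++ cycEdges c₂) (cycEdges c₁) ∘
                             xs⊆xs++ys (walkEdges p) (cycEdges c₂))
      into₃ : OtherEdgeAt (cycEdges c₂) e y → OtherEdgeAt handcuff e y
      into₃ = otherEdgeAt-⊆ (xs⊆ys++xs (walkEdges p ++ cycEdges c₂) (cycEdges c₁) ∘
                             xs⊆ys++xs (cycEdges c₂) (walkEdges p))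

      onCycle₁ : Incident y e → e ∈ cycEdges c₁ → OtherEdgeAt handcuff e y
      onCycle₁ y∈e e∈c₁ = [ into₁ , into₂ ]′
        (looseHandcuff-side c₁ p u≢v u∈c₁ (endpoint∈walkVerts p (inj₁ refl)) e∈c₁ y∈e)

      onCycle₂ : Incident y e → e ∈ cycEdges c₂ → OtherEdgeAt handcuff e y
      onCycle₂ y∈e e∈c₂ = [ into₃ , into₂ ]′
        (looseHandcuff-side c₂ p u≢v v∈c₂ (endpoint∈walkVerts p (inj₂ refl)) e∈c₂ y∈e)

      onPath : Incident y e → e ∈ walkEdges p → OtherEdgeAt handcuff e y
      onPath y∈e e∈p with path-otherEdgeAt p p-path e∈p y∈e
      ... | inj₁ other       = into₂ other
      ... | inj₂ (inj₁ refl) = into₁ (junction-otherEdgeAt c₁ p u∈c₁ meet₁ e∈p y∈e)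
      ... | inj₂ (inj₂ refl) = into₃ (junction-otherEdgeAt c₂ p v∈c₂ meet₂ e∈p y∈e)
  circuit-otherEdgeAt (theta u≢v p₁ p₂ p₃ path₁ path₂ path₃ _ _ _ d₁₂ d₁₃ d₂₃ _ _ _) e∈es x∈e =
    [ (λ e∈p₁ → [ into₁ , into₂ ]′ (theta-side u≢v p₁ p₂ path₁ d₁₂ e∈p₁ x∈e))
    , [ (λ e∈p₂ → [ into₂ , into₃ ]′ (theta-side u≢v p₂ p₃ path₂ d₂₃ e∈p₂ x∈e))
      , (λ e∈p₃ → [ into₃ , into₁ ]′ (theta-side u≢v p₃ p₁ path₃ (flip d₁₃) e∈p₃ x∈e))
      ]′ ∘ ∈-++⁻ (walkEdges p₂)
    ]′ (∈-++⁻ (walkEdges p₁) e∈es)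
    where
      into₁ = otherEdgeAt-⊆ (xs⊆xs++ys (walkEdges p₁) (walkEdges p₂ ++ walkEdges p₃))
      into₂ = otherEdgeAt-⊆ (xs⊆ys++xs (walkEdges p₂ ++ walkEdges p₃) (walkEdges p₁) ∘
                             xs⊆xs++ys (walkEdges p₂) (walkEdges p₃))
      into₃ = otherEdgeAt-⊆ (xs⊆ys++xs (walkEdges p₂ ++ walkEdges p₃) (walkEdges p₁) ∘
                             xs⊆ys++xs (walkEdges p₃) (walkEdges p₂))

  isCircuit-resp : {C D : Pred Edge 0ℓ} → C ≐ D → IsCircuit C → IsCircuit D
  isCircuit-resp (C⊆D , D⊆C) (es , cg , spans) =
    es , cg , λ e → proj₁ (spans e) ∘ D⊆C , C⊆D ∘ proj₂ (spans e)

  isCircuit-↭ : xs ↭ ys → IsCircuit (_∈ xs) → IsCircuit (_∈ ys)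
  isCircuit-↭ xs↭ys = isCircuit-resp (∈-resp-↭ xs↭ys , ∈-resp-↭ (↭-sym xs↭ys))

  circuitGraph⇒isCircuit : CircuitGraph es → IsCircuit (_∈ es)
  circuitGraph⇒isCircuit cg = _ , cg , λ _ → (λ e∈es → e∈es) , (λ e∈es → e∈es)

  triple-swap₁₂ : IsCircuit (_∈ P ∷ Q ∷ R ∷ []) → IsCircuit (_∈ Q ∷ P ∷ R ∷ [])
  triple-swap₁₂ = isCircuit-↭ (↭-swap _ _ ↭-refl)

  triple-swap₂₃ : IsCircuit (_∈ P ∷ Q ∷ R ∷ []) → IsCircuit (_∈ P ∷ R ∷ Q ∷ [])
  triple-swap₂₃ = isCircuit-↭ (↭-prep _ (↭-swap _ _ ↭-refl))

  triangle-cover : IsCircuit (_∈ P ∷ Q ∷ R ∷ []) → Incident x P → Incident x Q ⊎ Incident x R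
  triangle-cover (es , cg , spans) x∈P
    with circuit-otherEdgeAt cg (proj₁ (spans _) (here refl)) x∈P
  ... | e , e∈es , e≢P , x∈e with proj₂ (spans e) e∈es
  ... | here refl                 = ⊥-elim (e≢P refl)
  ... | there (here refl)         = inj₁ x∈e
  ... | there (there (here refl)) = inj₂ x∈e

  threeLoops-notCircuit : ∀ {i j k} → i ≢ j → i ≢ k → ¬ IsCircuit (_∈ loop i ∷ loop j ∷ loop k ∷ [])
  threeLoops-notCircuit i≢j i≢k T = [ i≢j , i≢k ]′ (triangle-cover T refl)

  -- c lies on P, Q and R, so each of them has room for at most one of a and b,
  -- whereas the triangles put each of a and b on two of them.
  triangles⇒incident : (a<b : a < b) → let A = arc a b a<b g in
    IsCircuit (_∈ A ∷ P ∷ Q ∷ []) → IsCircuit (_∈ A ∷ P ∷ R ∷ []) → IsCircuit (_∈ A ∷ Q ∷ R ∷ []) →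
    Incident x P → Incident x A
  triangles⇒incident {a = a} {b = b} {P = P} {Q = Q} {R = R} {x = c} a<b T₁ T₂ T₃ c∈P
    with c ≟ a | c ≟ b
  ... | yes c≡a | _       = inj₁ c≡a
  ... | no _    | yes c≡b = inj₂ c≡b
  ... | no c≢a  | no c≢b  =
    ⊥-elim (split (triangle-cover T₃ (inj₁ refl)) (triangle-cover T₃ (inj₂ refl)))
    where
      c∉A : ¬ (c ≡ a ⊎ c ≡ b)
      c∉A = [ c≢a , c≢b ]′

      c∈Q : Incident c Q
      c∈Q = fromInj₂ (⊥-elim ∘ c∉A) (triangle-cover (triple-swap₁₂ T₁) c∈P)

      c∈R : Incident c R
      c∈R = fromInj₂ (⊥-elim ∘ c∉A) (triangle-cover (triple-swap₁₂ T₂) c∈P)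

      crowded : Incident c e → Incident a e → Incident b e → ⊥
      crowded c∈e a∈e b∈e = incident-atMostTwo c∈e a∈e b∈e c≢a c≢b (<⇒≢ a<b)

      split : Incident a Q ⊎ Incident a R → Incident b Q ⊎ Incident b R → ⊥
      split (inj₁ a∈Q) (inj₁ b∈Q) = crowded c∈Q a∈Q b∈Q
      split (inj₂ a∈R) (inj₂ b∈R) = crowded c∈R a∈R b∈R
      split (inj₁ a∈Q) (inj₂ b∈R) with triangle-cover T₁ (inj₂ refl) | triangle-cover T₂ (inj₁ refl)
      ... | inj₂ b∈Q | _        = crowded c∈Q a∈Q b∈Q
      ... | inj₁ b∈P | inj₁ a∈P = crowded c∈P a∈P b∈P
      ... | inj₁ _   | inj₂ a∈R = crowded c∈R a∈R b∈R
      split (inj₂ a∈R) (inj₁ b∈Q) with triangle-cover T₂ (inj₂ refl) | triangle-cover T₁ (inj₁ refl)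
      ... | inj₂ b∈R | _        = crowded c∈R a∈R b∈R
      ... | inj₁ b∈P | inj₁ a∈P = crowded c∈P a∈P b∈P
      ... | inj₁ _   | inj₂ a∈Q = crowded c∈Q a∈Q b∈Q

  module _ {a b : V} (a<b : a < b) where
    private
      a≢b : a ≢ b
      a≢b = <⇒≢ a<b

      arcPath : ∀ g → IsPath (fwd a<b g ∷ [])
      arcPath _ = (a≢b ∷ []) ∷ [] ∷ []

      labels-≢ : arc a b a<b g ≢ arc a b a<b h → g ≢ h
      labels-≢ arcs-≢ refl = arcs-≢ refl

      digon : g ≢ h → Cycle
      digon {g} {h} g≢h = polyC (fwd a<b g) (bwd a<b h ∷ []) ((a≢b ∘ sym ∷ []) ∷ [] ∷ [])
                        (λ { (here refl) → g≢h refl })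

      digon-unbalanced : (g≢h : g ≢ h) → Unbalanced (digon g≢h)
      digon-unbalanced g≢h balanced =
        g≢h (x∙y⁻¹≈ε⇒x≈y _ _ (subst (λ z → _ ∙ z ≡ ε) (identityʳ _) balanced))

    loop-arc-loop : ∀ g → CircuitGraph (loop a ∷ arc a b a<b g ∷ loop b ∷ [])
    loop-arc-loop g = looseHandcuff (loopC a) (loopC b) (λ ()) (λ ()) apart (fwd a<b g ∷ []) (arcPath g)
                        (here refl) (here refl) (λ _ → singleton⁻) (λ _ → singleton⁻)
      where
        apart : Disjoint (a ∷ []) (b ∷ [])
        apart (here refl) (here refl) = a≢b refl

    loop-digon : w ∈ b ∷ a ∷ [] → g ≢ h → CircuitGraph (loop w ∷ arc a b a<b g ∷ arc a b a<b h ∷ [])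
    loop-digon {w = w} w∈digon g≢h =
      tightHandcuff (loopC w) (digon g≢h) (λ ()) (digon-unbalanced g≢h) apart w
                    (here refl) w∈digon (λ w′∈w _ → singleton⁻ w′∈w)
      where
        apart : Disjoint (loop w ∷ []) (cycEdges (digon g≢h))
        apart (here refl) (here ())
        apart (here refl) (there (here ()))

    arc-arc-arc : ∀ {g₁ g₂ g₃} → g₁ ≢ g₂ → g₁ ≢ g₃ → g₂ ≢ g₃ →
                  CircuitGraph (arc a b a<b g₁ ∷ arc a b a<b g₂ ∷ arc a b a<b g₃ ∷ [])
    arc-arc-arc {g₁} {g₂} {g₃} g₁≢g₂ g₁≢g₃ g₂≢g₃ =
      theta a≢b (fwd a<b g₁ ∷ []) (fwd a<b g₂ ∷ []) (fwd a<b g₃ ∷ []) (arcPath g₁) (arcPath g₂) (arcPath g₃)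
            meet meet meet (apart g₁≢g₂) (apart g₁≢g₃) (apart g₂≢g₃)
            (unbalanced g₁≢g₂) (unbalanced g₁≢g₃) (unbalanced g₂≢g₃)
      where
        meet : x ∈ a ∷ b ∷ [] → x ∈ a ∷ b ∷ [] → x ≡ a ⊎ x ≡ b
        meet (here x≡a)  _ = inj₁ x≡a
        meet (there x∈b) _ = inj₂ (singleton⁻ x∈b)

        apart : g ≢ h → Disjoint (arc a b a<b g ∷ []) (arc a b a<b h ∷ [])
        apart g≢h (here refl) (here refl) = g≢h refl

        unbalanced : g ≢ h → (g ∙ ε) ∙ (h ∙ ε) ⁻¹ ≢ ε
        unbalanced {g} {h} g≢h =
          g≢h ∘ x∙y⁻¹≈ε⇒x≈y g h ∘ subst₂ (λ r s → r ∙ s ⁻¹ ≡ ε) (identityʳ g) (identityʳ h)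

    data OnPair : Edge → Set where
      loopˡ    : OnPair (loop a)
      loopʳ    : OnPair (loop b)
      parallel : ∀ h → OnPair (arc a b a<b h)

    incident⇒onPair : (∀ {x} → Incident x e → x ≡ a ⊎ x ≡ b) → OnPair e
    incident⇒onPair {e = loop _} ends with ends refl
    ... | inj₁ refl = loopˡ
    ... | inj₂ refl = loopʳ
    incident⇒onPair {e = arc _ _ i<j h} ends with ends (inj₁ refl) | ends (inj₂ refl)
    ... | inj₁ refl | inj₁ refl = ⊥-elim (<⇒≢ i<j refl)
    ... | inj₂ refl | inj₂ refl = ⊥-elim (<⇒≢ i<j refl)
    ... | inj₂ refl | inj₁ refl = ⊥-elim (<-asym a<b i<j)
    ... | inj₁ refl | inj₂ refl rewrite <-irrelevant i<j a<b = parallel h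

    arcTriple-isCircuit : ∀ g → OnPair P → OnPair Q →
                          arc a b a<b g ≢ P → arc a b a<b g ≢ Q → P ≢ Q →
                          IsCircuit (_∈ arc a b a<b g ∷ P ∷ Q ∷ [])
    arcTriple-isCircuit _ loopˡ loopˡ _ _ P≢Q = ⊥-elim (P≢Q refl)
    arcTriple-isCircuit _ loopʳ loopʳ _ _ P≢Q = ⊥-elim (P≢Q refl)
    arcTriple-isCircuit g loopˡ loopʳ _ _ _ =
      triple-swap₁₂ (circuitGraph⇒isCircuit (loop-arc-loop g))
    arcTriple-isCircuit g loopʳ loopˡ _ _ _ =
      triple-swap₂₃ (triple-swap₁₂ (circuitGraph⇒isCircuit (loop-arc-loop g)))
    arcTriple-isCircuit _ loopˡ (parallel _) _ A≢Q _ =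
      triple-swap₁₂ (circuitGraph⇒isCircuit (loop-digon (there (here refl)) (labels-≢ A≢Q)))
    arcTriple-isCircuit _ (parallel _) loopˡ A≢P _ _ =
      triple-swap₂₃ (triple-swap₁₂ (circuitGraph⇒isCircuit (loop-digon (there (here refl)) (labels-≢ A≢P))))
    arcTriple-isCircuit _ loopʳ (parallel _) _ A≢Q _ =
      triple-swap₁₂ (circuitGraph⇒isCircuit (loop-digon (here refl) (labels-≢ A≢Q)))
    arcTriple-isCircuit _ (parallel _) loopʳ A≢P _ _ =
      triple-swap₂₃ (triple-swap₁₂ (circuitGraph⇒isCircuit (loop-digon (here refl) (labels-≢ A≢P))))
    arcTriple-isCircuit _ (parallel _) (parallel _) A≢P A≢Q P≢Q =
      circuitGraph⇒isCircuit (arc-arc-arc (labels-≢ A≢P) (labels-≢ A≢Q) (labels-≢ P≢Q))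

  loops-onPair : ∀ {i j} → i ≢ j →
                 ∃₂ λ a b → Σ (a < b) λ a<b → OnPair a<b (loop i) × OnPair a<b (loop j)
  loops-onPair {i} {j} i≢j with <-cmp i j
  ... | tri< i<j _ _ = i , j , i<j , loopˡ , loopʳ
  ... | tri≈ _ i≡j _ = ⊥-elim (i≢j i≡j)
  ... | tri> _ _ j<i = j , i , j<i , loopʳ , loopˡ

  loop-loop-arc-isCircuit : ∀ {i j} (a<b : a < b) g → OnPair a<b (loop i) → OnPair a<b (loop j) → i ≢ j →
                            IsCircuit (_∈ loop i ∷ loop j ∷ arc a b a<b g ∷ [])
  loop-loop-arc-isCircuit a<b g i-on j-on i≢j =
    triple-swap₂₃ (triple-swap₁₂
      (arcTriple-isCircuit a<b g i-on j-on (λ ()) (λ ()) (λ { refl → i≢j refl })))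

  loop-arc-arc-isCircuit : ∀ {i} (a<b : a < b) → OnPair a<b (loop i) → g ≢ h →
                           IsCircuit (_∈ loop i ∷ arc a b a<b g ∷ arc a b a<b h ∷ [])
  loop-arc-arc-isCircuit {g = g} {h = h} a<b i-on g≢h =
    triple-swap₁₂ (arcTriple-isCircuit a<b g i-on (parallel h) (λ ()) (λ { refl → g≢h refl }) (λ ()))

image-∈ : {A B : Set} (f : A → B) (xs : List A) → image f (_∈ xs) ≐ (_∈ map f xs)
image-∈ f xs =
  (λ { (x , x∈xs , refl) → ∈-map⁺ f x∈xs }) ,
  (λ y∈fxs → let x , x∈xs , y≡fx = ∈-map⁻ f y∈fxs in x , x∈xs , sym y≡fx)

module _ {Γ Γ′ : FinGroup} {n t : ℕ} {ψ : Gain.Edge Γ′ t → Gain.Edge Γ n}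
         (embedding : IsEmbedding Γ′ t Γ n ψ) where
  private
    module G = Gain Γ n
    module H = Gain Γ′ t
    module FMΓ = FrameMatroid Γ n
    module FMΓ′ = FrameMatroid Γ′ t
    open Equivalence using (to; from)

  embedding-isCircuit⇔ : (xs : List H.Edge) → H.IsCircuit (_∈ xs) ⇔ G.IsCircuit (_∈ map ψ xs)
  embedding-isCircuit⇔ xs = mk⇔
    (FMΓ.isCircuit-resp (image-∈ ψ xs) ∘ proj₁ (proj₂ embedding (_∈ xs)))
    (proj₂ (proj₂ embedding (_∈ xs)) ∘ FMΓ.isCircuit-resp (≐-sym (image-∈ ψ xs)))

  ψ-loop-injective : ∀ {i j} → ψ (H.loop i) ≡ ψ (H.loop j) → i ≡ j
  ψ-loop-injective ψbᵢ≡ψbⱼ with proj₁ embedding ψbᵢ≡ψbⱼ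
  ... | refl = refl

  embedding-loop≢arc : Nontrivial Γ′ → ∀ {i j k} → i ≢ j → i ≢ k → j ≢ k →
                       ∀ {a b} (a<b : a < b) g → ψ (H.loop i) ≢ G.arc a b a<b g
  embedding-loop≢arc (x , x≢ε) {i} {j} {k} i≢j i≢k j≢k a<b g ψbᵢ≡A =
    FMΓ′.threeLoops-notCircuit i≢j i≢k (from (embedding-isCircuit⇔ (H.loop i ∷ H.loop j ∷ H.loop k ∷ []))
      (fromA (FMΓ.arcTriple-isCircuit a<b g (ψb-onPair i≢j) (ψb-onPair i≢k) (A≢ψb i≢j) (A≢ψb i≢k)
                                      (j≢k ∘ ψ-loop-injective))))
    where
      A = G.arc _ _ a<b g

      atA : ∀ {Es} → G.IsCircuit (_∈ ψ (H.loop i) ∷ Es) → G.IsCircuit (_∈ A ∷ Es)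
      atA {Es} = subst (λ E → G.IsCircuit (_∈ E ∷ Es)) ψbᵢ≡A

      fromA : ∀ {Es} → G.IsCircuit (_∈ A ∷ Es) → G.IsCircuit (_∈ ψ (H.loop i) ∷ Es)
      fromA {Es} = subst (λ E → G.IsCircuit (_∈ E ∷ Es)) (sym ψbᵢ≡A)

      A≢ψb : ∀ {j} → i ≢ j → A ≢ ψ (H.loop j)
      A≢ψb i≢j A≡ψbⱼ = i≢j (ψ-loop-injective (trans ψbᵢ≡A A≡ψbⱼ))

      ψb-onPair : ∀ {j} → i ≢ j → FMΓ.OnPair a<b (ψ (H.loop j))
      ψb-onPair i≢j with FMΓ′.loops-onPair i≢j
      ... | _ , _ , c<d , i-on , j-on =
        FMΓ.incident⇒onPair a<b (FMΓ.triangles⇒incident a<b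
          (atA (to (embedding-isCircuit⇔ _) (FMΓ′.loop-loop-arc-isCircuit c<d (FinGroup.ε Γ′) i-on j-on i≢j)))
          (atA (to (embedding-isCircuit⇔ _) (FMΓ′.loop-loop-arc-isCircuit c<d x i-on j-on i≢j)))
          (atA (to (embedding-isCircuit⇔ _) (FMΓ′.loop-arc-arc-isCircuit c<d i-on (x≢ε ∘ sym)))))

  embedding-loop-isJoint : Nontrivial Γ′ → ∀ {i j k} → i ≢ j → i ≢ k → j ≢ k → G.IsJoint (ψ (H.loop i))
  embedding-loop-isJoint nontrivial {i} i≢j i≢k j≢k with ψ (H.loop i) in ψbᵢ≡e
  ... | G.loop l        = l , refl
  ... | G.arc _ _ a<b g = ⊥-elim (embedding-loop≢arc nontrivial i≢j i≢k j≢k a<b g ψbᵢ≡e)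

twoOthers : ∀ {m} (i : Fin (3 + m)) → ∃₂ λ j k → i ≢ j × i ≢ k × j ≢ k
twoOthers zero          = suc zero , suc (suc zero) , (λ ()) , (λ ()) , (λ ())
twoOthers (suc zero)    = zero , suc (suc zero) , (λ ()) , (λ ()) , (λ ())
twoOthers (suc (suc _)) = zero , suc zero , (λ ()) , (λ ()) , (λ ())

lemma3p1 : (n t : ℕ) → 3 ≤ t → t ≤ n →
    (Γ Γ' : FinGroup) →
    (ι : ∣ Γ' ∣ → ∣ Γ ∣) → IsSubgroupEmbedding Γ' Γ ι →
    Nontrivial Γ' →
    (ψ : Gain.Edge Γ' t → Gain.Edge Γ n) → IsEmbedding Γ' t Γ n ψ →
    ∀ (e : Gain.Edge Γ' t) → Gain.IsJoint Γ' t e → Gain.IsJoint Γ n (ψ e)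
lemma3p1 n _ (s≤s (s≤s (s≤s _))) _ Γ Γ' _ _ nontrivial ψ embedding _ (i , refl) =
  let j , k , i≢j , i≢k , j≢k = twoOthers i
  in embedding-loop-isJoint embedding nontrivial i≢j i≢k j≢k
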